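{- Let $G=(V,E)$ and $G'=(V,E')$ be distinct graphs on the same vertex set $V$ with $|E|\ge|E'|$. Then $|q^*(G)-q^*(G')|<\frac{2|E\setminus E'|}{|E|}$.
   Context: For a graph $G$ with $m\ge 1$ edges and a vertex partition $\mathcal A$, $q_{\mathcal A}(G)=\frac1m\sum_{A\in\mathcal A}e(A)-\frac{1}{4m^2}\sum_{A\in\mathcal A}\mathrm{vol}(A)^2$ ($e(A)$: number of edges within $A$; $\mathrm{vol}(A)$: sum of degrees in $A$); $q^*(G)=\max_{\mathcal A}q_{\mathcal A}(G)$ over all vertex partitions, and by convention $q^*(G)=0$ if $G$ has no edges. -}

module Defs where

open import Data.Nat as ℕ using (ℕ; zero; suc; _<ᵇ_; _*_)
open import Data.Integer as ℤ using (+_)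
open import Data.Rational as ℚ using (ℚ; _/_; _-_; _⊔_)
open import Data.Bool using (Bool; true; false; if_then_else_; _∧_; not)
open import Data.Fin as Fin using (Fin; toℕ; _≟_)
open import Data.Product using (_×_; _,_)
open import Data.List using (List; []; _∷_; map; concatMap; allFin)
open import Data.Nat.ListAction using (sum)
open import Data.Vec as Vec using (Vec; []; _∷_; lookup)
open import Relation.Nullary.Decidable using (⌊_⌋)
open import Relation.Binary.PropositionalEquality using (_≡_)

record Graph (n : ℕ) : Set where
  field
    adj    : Fin n → Fin n → Bool
    sym    : ∀ i j → adj i j ≡ adj j i
    irrefl : ∀ i → adj i i ≡ false
open Graph public

count : ∀ {A : Set} → (A → Bool) → List A → ℕ
count p xs = sum (map (λ x → if p x then 1 else 0) xs)

-- unordered pairs {i , j} of vertices, represented as (i , j) with i < j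
pairs : (n : ℕ) → List (Fin n × Fin n)
pairs n = concatMap (λ i → concatMap (λ j → if toℕ i <ᵇ toℕ j then (i , j) ∷ [] else []) (allFin n)) (allFin n)

numEdges : ∀ {n} → Graph n → ℕ
numEdges {n} G = count (λ { (i , j) → adj G i j }) (pairs n)

edgeDiff : ∀ {n} → Graph n → Graph n → ℕ
edgeDiff {n} G G' = count (λ { (i , j) → adj G i j ∧ not (adj G' i j) }) (pairs n)

deg : ∀ {n} → Graph n → Fin n → ℕ
deg {n} G i = count (adj G i) (allFin n)

-- A vertex partition is given by a labelling f : V → Fin n (parts are the
-- nonempty fibres A_k = f⁻¹(k); every partition of V arises this way,
-- and empty fibres contribute 0 to every sum below).
Labelling : ℕ → Set
Labelling n = Vec (Fin n) n

inPart : ∀ {n} → Labelling n → Fin n → Fin n → Bool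
inPart f k i = ⌊ lookup f i ≟ k ⌋

eIn : ∀ {n} → Graph n → Labelling n → Fin n → ℕ
eIn {n} G f k = count (λ { (i , j) → adj G i j ∧ (inPart f k i ∧ inPart f k j) }) (pairs n)

vol : ∀ {n} → Graph n → Labelling n → Fin n → ℕ
vol {n} G f k = sum (map (λ i → if inPart f k i then deg G i else 0) (allFin n))

-- a / b as a rational (only used with b ≠ 0; value 0 when b = 0)
divℕ : ℕ → ℕ → ℚ
divℕ a zero    = ℚ.0ℚ
divℕ a (suc b) = (+ a) / suc b

modularity : ∀ {n} → Graph n → Labelling n → ℚ
modularity {n} G f =
  divℕ (sum (map (eIn G f) (allFin n))) m
    - divℕ (sum (map (λ k → vol G f k * vol G f k) (allFin n))) (4 * m * m)
  where m = numEdges G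

allVecs : (n k : ℕ) → List (Vec (Fin n) k)
allVecs n zero    = [] ∷ []
allVecs n (suc k) = concatMap (λ x → map (x ∷_) (allVecs n k)) (allFin n)

-- maximum of a list (0 for the empty list, which never occurs below)
maxList : List ℚ → ℚ
maxList []       = ℚ.0ℚ
maxList (x ∷ xs) = go x xs
  where
  go : ℚ → List ℚ → ℚ
  go acc []       = acc
  go acc (y ∷ ys) = go (acc ⊔ y) ys

qStar : ∀ {n} → Graph n → ℚ
qStar {n} G with numEdges G
... | zero  = ℚ.0ℚ
... | suc _ = maxList (map (modularity G) (allVecs n n))

module Submission where

-- Index the potential edges by the unordered pairs p = {i , j} and let x, y be
-- the edge indicators of G and G'.  For a fixed partition, Σ_A e(A) sums x over
-- the pairs inside a part, and (handshake lemma) Σ_A vol(A)² = Σ_{p,p'} x(p) x(p') K(p,p')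
-- for the kernel K(p,p') = Σ_k c_k(p) c_k(p'), where c_k(p) counts the ends of p in
-- part k.  With m = |E| and m' = |E'| the numerator N = 4m²m'²(q_A(G) − q_A(G'))
-- equals Σ_p g(p) (m' x(p) − m y(p)) for coefficients with 0 ≤ g(p) ≤ 8mm' − 1 wherever
-- x(p) or y(p) is 1.  Splitting m' x − m y into a non-negative gain and loss, both of
-- total m'|E ∖ E'|, gives |N| < 8mm'²|E ∖ E'|, that is |q_A(G) − q_A(G')| < 2|E ∖ E'|/m.
-- If G' is empty (q* = 0 by convention) the same bound reads |q_A(G)| < 2.  Finally,
-- maxima of pointwise close functions are close.

module IntegerSums where

  open import Data.Bool using (Bool; true; false)
  open import Data.Nat using (ℕ)
  open import Data.Integer as ℤ using (ℤ; +_; _+_; _*_; _-_; -_; _≤_)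
  import Data.Integer.Properties as ℤP
  open import Data.Integer.Tactic.RingSolver using (solve-∀)
  open import Data.List using (List; []; _∷_; _++_; map; concatMap)
  open import Data.List.Membership.Propositional using (_∈_)
  open import Data.List.Relation.Unary.Any using (here; there)
  open import Data.Nat.ListAction using (sum)
  open import Relation.Binary.PropositionalEquality

  private variable A B : Set

  𝟙 : Bool → ℤ
  𝟙 true  = + 1
  𝟙 false = + 0

  ∑ : List A → (A → ℤ) → ℤ
  ∑ []       f = + 0
  ∑ (a ∷ as) f = f a + ∑ as f

  ∑-cong : ∀ (xs : List A) {f g : A → ℤ} → (∀ a → f a ≡ g a) → ∑ xs f ≡ ∑ xs g
  ∑-cong []       f≡g = refl
  ∑-cong (a ∷ as) f≡g = cong₂ _+_ (f≡g a) (∑-cong as f≡g)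

  ∑-zero : ∀ (xs : List A) → ∑ xs (λ _ → + 0) ≡ + 0
  ∑-zero []       = refl
  ∑-zero (a ∷ as) = trans (ℤP.+-identityˡ (∑ as (λ _ → + 0))) (∑-zero as)

  ∑-++ : ∀ (xs ys : List A) f → ∑ (xs ++ ys) f ≡ ∑ xs f + ∑ ys f
  ∑-++ []       ys f = sym (ℤP.+-identityˡ (∑ ys f))
  ∑-++ (a ∷ as) ys f = trans (cong (_+_ (f a)) (∑-++ as ys f)) (sym (ℤP.+-assoc (f a) _ _))

  ∑-concatMap : ∀ (g : A → List B) (xs : List A) f → ∑ (concatMap g xs) f ≡ ∑ xs (λ a → ∑ (g a) f)
  ∑-concatMap g []       f = refl
  ∑-concatMap g (a ∷ as) f = trans (∑-++ (g a) (concatMap g as) f) (cong (_+_ (∑ (g a) f)) (∑-concatMap g as f))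

  ∑-+ : ∀ (xs : List A) f g → ∑ xs (λ a → f a + g a) ≡ ∑ xs f + ∑ xs g
  ∑-+ []       f g = refl
  ∑-+ (a ∷ as) f g = trans (cong (_+_ (f a + g a)) (∑-+ as f g)) (interchange (f a) (g a) (∑ as f) (∑ as g))
    where
    interchange : ∀ u v w z → u + v + (w + z) ≡ u + w + (v + z)
    interchange = solve-∀

  ∑-*ˡ : ∀ (xs : List A) c f → ∑ xs (λ a → c * f a) ≡ c * ∑ xs f
  ∑-*ˡ []       c f = sym (ℤP.*-zeroʳ c)
  ∑-*ˡ (a ∷ as) c f = trans (cong (_+_ (c * f a)) (∑-*ˡ as c f)) (sym (ℤP.*-distribˡ-+ c (f a) (∑ as f)))

  ∑-*ʳ : ∀ (xs : List A) c f → ∑ xs (λ a → f a * c) ≡ ∑ xs f * c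
  ∑-*ʳ xs c f = trans (∑-cong xs (λ a → ℤP.*-comm (f a) c)) (trans (∑-*ˡ xs c f) (ℤP.*-comm c (∑ xs f)))

  ∑-neg : ∀ (xs : List A) f → ∑ xs (λ a → - f a) ≡ - ∑ xs f
  ∑-neg []       f = refl
  ∑-neg (a ∷ as) f = trans (cong (_+_ (- f a)) (∑-neg as f)) (sym (ℤP.neg-distrib-+ (f a) (∑ as f)))

  ∑-- : ∀ (xs : List A) f g → ∑ xs (λ a → f a - g a) ≡ ∑ xs f - ∑ xs g
  ∑-- xs f g = trans (∑-+ xs f (λ a → - g a)) (cong (_+_ (∑ xs f)) (∑-neg xs g))

  ∑-swap : ∀ (xs : List A) (ys : List B) (F : A → B → ℤ) → ∑ xs (λ a → ∑ ys (F a)) ≡ ∑ ys (λ b → ∑ xs (λ a → F a b))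
  ∑-swap []       ys F = sym (∑-zero ys)
  ∑-swap (a ∷ as) ys F = trans (cong (_+_ (∑ ys (F a))) (∑-swap as ys F)) (sym (∑-+ ys (F a) _))

  ∑-product : ∀ (xs : List A) (ys : List B) (u : A → ℤ) (v : B → ℤ) → ∑ xs u * ∑ ys v ≡ ∑ xs (λ a → ∑ ys (λ b → u a * v b))
  ∑-product xs ys u v = begin
    ∑ xs u * ∑ ys v                        ≡⟨ sym (∑-*ʳ xs (∑ ys v) u) ⟩
    ∑ xs (λ a → u a * ∑ ys v)              ≡⟨ ∑-cong xs (λ a → sym (∑-*ˡ ys (u a) v)) ⟩
    ∑ xs (λ a → ∑ ys (λ b → u a * v b))    ∎
    where open ≡-Reasoning

  ∑-mono : ∀ (xs : List A) {f g} → (∀ a → a ∈ xs → f a ≤ g a) → ∑ xs f ≤ ∑ xs g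
  ∑-mono []       f≤g = ℤP.≤-refl
  ∑-mono (a ∷ as) f≤g = ℤP.+-mono-≤ (f≤g a (here refl)) (∑-mono as (λ b b∈ → f≤g b (there b∈)))

  ∑-nonneg : ∀ (xs : List A) {f} → (∀ a → + 0 ≤ f a) → + 0 ≤ ∑ xs f
  ∑-nonneg xs {f} f≥0 = subst (_≤ ∑ xs f) (∑-zero xs) (∑-mono xs (λ a _ → f≥0 a))

  term≤∑ : ∀ (xs : List A) f {a} → (∀ b → + 0 ≤ f b) → a ∈ xs → f a ≤ ∑ xs f
  term≤∑ (b ∷ bs) f f≥0 (here refl) = ℤP.i≤i+j (f b) (∑ bs f) {{ℤ.nonNegative (∑-nonneg bs f≥0)}}
  term≤∑ (b ∷ bs) f f≥0 (there a∈)  = ℤP.i≤j⇒i≤k+j (f b) {{ℤ.nonNegative (f≥0 b)}} (term≤∑ bs f f≥0 a∈)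

  sum-as-∑ : ∀ (xs : List A) (f : A → ℕ) → + sum (map f xs) ≡ ∑ xs (λ a → + f a)
  sum-as-∑ []       f = refl
  sum-as-∑ (a ∷ as) f = trans (ℤP.pos-+ (f a) (sum (map f as))) (cong (_+_ (+ f a)) (sum-as-∑ as f))


module AbstractModularity where

  open import Data.Bool using (Bool; true; false)
  open import Data.Integer as ℤ using (ℤ; +_; _+_; _*_; _-_; -_; _≤_; _<_; +≤+)
  import Data.Integer.Properties as ℤP
  open import Data.Integer.Tactic.RingSolver using (solve-∀)
  open import Data.List using (List)
  open import Data.List.Membership.Propositional using (_∈_)
  open import Data.Nat using (z≤n; s≤s)
  open import Data.Product using (_×_; _,_; proj₁; proj₂)
  open import Data.Sum using (_⊎_; inj₁; inj₂)
  open import Relation.Binary.PropositionalEquality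
  open IntegerSums

  private variable I : Set

  *-nonneg : ∀ {a b} → + 0 ≤ a → + 0 ≤ b → + 0 ≤ a * b
  *-nonneg {a} {b} 0≤a 0≤b =
    subst (_≤ a * b) (ℤP.*-zeroʳ a) (ℤP.*-monoˡ-≤-nonNeg a {{ℤ.nonNegative 0≤a}} 0≤b)

  1≤* : ∀ {a b} → + 1 ≤ a → + 1 ≤ b → + 1 ≤ a * b
  1≤* {a} {b} 1≤a 1≤b = ℤP.≤-trans 1≤b (subst (_≤ a * b) (ℤP.*-identityˡ b)
    (ℤP.*-monoʳ-≤-nonNeg b {{ℤ.nonNegative (ℤP.≤-trans (+≤+ z≤n) 1≤b)}} 1≤a))

  ≤-by-difference : ∀ {a b} c → b - a ≡ c → + 0 ≤ c → a ≤ b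
  ≤-by-difference c b-a≡c 0≤c = ℤP.0≤i-j⇒j≤i (subst (+ 0 ≤_) (sym b-a≡c) 0≤c)

  <-by-difference : ∀ {a b} c → b - a ≡ c → + 1 ≤ c → a < b
  <-by-difference {a} {b} c b-a≡c 1≤c = ℤP.suc[i]≤j⇒i<j
    (≤-by-difference (c - + 1) (trans (shift a b) (cong (_- + 1) b-a≡c)) (ℤP.i≤j⇒0≤j-i 1≤c))
    where
    shift : ∀ a b → b - (+ 1 + a) ≡ (b - a) - + 1
    shift = solve-∀

  𝟙-nonneg : ∀ b → + 0 ≤ 𝟙 b
  𝟙-nonneg true  = +≤+ z≤n
  𝟙-nonneg false = +≤+ z≤n

  bit-cases : ∀ b → b ≡ true ⊎ b ≡ false
  bit-cases true  = inj₁ refl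
  bit-cases false = inj₂ refl

  𝟙-≤1 : ∀ b → 𝟙 b ≤ + 1
  𝟙-≤1 true  = +≤+ (s≤s z≤n)
  𝟙-≤1 false = +≤+ z≤n

  scaled≤ : ∀ {v} → + 0 ≤ v → ∀ {a b} → a ≤ b → a * v ≤ b * v
  scaled≤ {v} 0≤v = ℤP.*-monoʳ-≤-nonNeg v {{ℤ.nonNegative 0≤v}}

  vanishing : ∀ {v} → v ≡ + 0 → ∀ a b → a * v ≤ b * v
  vanishing refl a b = ℤP.≤-reflexive (trans (ℤP.*-zeroʳ a) (sym (ℤP.*-zeroʳ b)))

  bracket : ∀ {g u r} c → + 0 ≤ g → + 0 ≤ u → + 0 ≤ r → g * u ≤ c * u → g * r ≤ c * r
          → g * (u - r) ≤ c * u × - (c * r) ≤ g * (u - r)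
  bracket {g} {u} {r} c 0≤g 0≤u 0≤r gu≤cu gr≤cr =
    ≤-by-difference ((c * u - g * u) + g * r) (upper g u r c)
                    (ℤP.+-mono-≤ (ℤP.i≤j⇒0≤j-i gu≤cu) (*-nonneg 0≤g 0≤r)) ,
    ≤-by-difference (g * u + (c * r - g * r)) (lower g u r c)
                    (ℤP.+-mono-≤ (*-nonneg 0≤g 0≤u) (ℤP.i≤j⇒0≤j-i gr≤cr))
    where
    upper : ∀ g u r c → c * u - g * (u - r) ≡ (c * u - g * u) + g * r
    upper = solve-∀
    lower : ∀ g u r c → g * (u - r) - - (c * r) ≡ g * u + (c * r - g * r)
    lower = solve-∀

  form : List I → (I → I → ℤ) → (I → ℤ) → (I → ℤ) → ℤ
  form P K u v = ∑ P λ p → ∑ P λ p' → u p * v p' * K p p'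

  form-const : ∀ (P : List I) c u v → form P (λ _ _ → c) u v ≡ c * (∑ P u * ∑ P v)
  form-const P c u v = begin
    ∑ P (λ p → ∑ P (λ p' → u p * v p' * c))   ≡⟨ ∑-cong P (λ p → trans (∑-*ʳ P c (λ p' → u p * v p')) (ℤP.*-comm _ c)) ⟩
    ∑ P (λ p → c * ∑ P (λ p' → u p * v p'))   ≡⟨ ∑-*ˡ P c _ ⟩
    c * ∑ P (λ p → ∑ P (λ p' → u p * v p'))   ≡⟨ cong (c *_) (sym (∑-product P P u v)) ⟩
    c * (∑ P u * ∑ P v)                       ∎
    where open ≡-Reasoning

  module _ (P : List I) (K : I → I → ℤ) where

    form-potential : ∀ u w → ∑ P (λ p → ∑ P (λ p' → K p p' * w p') * u p) ≡ form P K u w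
    form-potential u w = ∑-cong P λ p → trans (sym (∑-*ʳ P (u p) _)) (∑-cong P λ p' → reorder (K p p') (w p') (u p))
      where
      reorder : ∀ κ a b → κ * a * b ≡ b * a * κ
      reorder = solve-∀

    form-scale : ∀ a b u v → form P K (λ p → a * u p) (λ p → b * v p) ≡ a * b * form P K u v
    form-scale a b u v = begin
      form P K (λ p → a * u p) (λ p → b * v p)                     ≡⟨ ∑-cong P (λ p → ∑-cong P λ p' → reorder a b (u p) (v p') (K p p')) ⟩
      ∑ P (λ p → ∑ P (λ p' → a * b * (u p * v p' * K p p')))       ≡⟨ ∑-cong P (λ p → ∑-*ˡ P (a * b) _) ⟩
      ∑ P (λ p → a * b * ∑ P (λ p' → u p * v p' * K p p'))         ≡⟨ ∑-*ˡ P (a * b) _ ⟩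
      a * b * form P K u v                                         ∎
      where
      open ≡-Reasoning
      reorder : ∀ a b x y κ → a * x * (b * y) * κ ≡ a * b * (x * y * κ)
      reorder = solve-∀

    module _ (K-sym : ∀ p p' → K p p' ≡ K p' p) where

      form-sym : ∀ u v → form P K u v ≡ form P K v u
      form-sym u v = trans (∑-swap P P _) (∑-cong P λ p → ∑-cong P λ p' →
        trans (cong (u p' * v p *_) (K-sym p' p)) (cong (_* K p p') (ℤP.*-comm (u p') (v p))))

      form-difference-of-squares : ∀ u v →
        form P K (λ p → u p - v p) (λ p → u p + v p) ≡ form P K u u - form P K v v
      form-difference-of-squares u v = begin
        form P K (λ p → u p - v p) (λ p → u p + v p)
          ≡⟨ ∑-cong P (λ p → ∑-cong P λ p' → expand (u p) (v p) (u p') (v p') (K p p')) ⟩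
        ∑ P (λ p → ∑ P (λ p' → (uu p p' - vv p p') + (uv p p' - vu p p')))
          ≡⟨ ∑-cong P (λ p → trans (∑-+ P _ _) (cong₂ _+_ (∑-- P _ _) (∑-- P _ _))) ⟩
        ∑ P (λ p → (∑ P (uu p) - ∑ P (vv p)) + (∑ P (uv p) - ∑ P (vu p)))
          ≡⟨ trans (∑-+ P _ _) (cong₂ _+_ (∑-- P _ _) (∑-- P _ _)) ⟩
        (form P K u u - form P K v v) + (form P K u v - form P K v u)
          ≡⟨ cong (λ z → (form P K u u - form P K v v) + (z - form P K v u)) (form-sym u v) ⟩
        (form P K u u - form P K v v) + (form P K v u - form P K v u)
          ≡⟨ cancel (form P K u u - form P K v v) (form P K v u) ⟩
        form P K u u - form P K v v ∎
        where
        open ≡-Reasoning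
        uu vv uv vu : I → I → ℤ
        uu p p' = u p * u p' * K p p'
        vv p p' = v p * v p' * K p p'
        uv p p' = u p * v p' * K p p'
        vu p p' = v p * u p' * K p p'
        expand : ∀ a b a' b' κ → (a - b) * (a' + b') * κ
                               ≡ (a * a' * κ - b * b' * κ) + (a * b' * κ - b * a' * κ)
        expand = solve-∀
        cancel : ∀ d w → d + (w - w) ≡ d
        cancel = solve-∀

  -- The numerator 4 m² m'² (e/m − s/(4m²) − e'/m' + s'/(4m'²)) of a difference of
  -- two modularity values, and the bound 4 m² m'² · 2k/m we compare it with.
  gapNumerator : (m m' e s e' s' : ℤ) → ℤ
  gapNumerator m m' e s e' s' = + 4 * m * m' * m' * e - m' * m' * s - (+ 4 * m * m * m' * e' - m * m * s')

  gapBound : (m m' k : ℤ) → ℤ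
  gapBound m m' k = + 8 * m * m' * m' * k

  _strictlyWithin_ : ℤ → ℤ → Set
  a strictlyWithin t = a < t × - a < t

  gap-cong : ∀ {m₁ m₂ m₁' m₂' e₁ e₂ s₁ s₂ e₁' e₂' s₁' s₂' k₁ k₂} →
    m₁ ≡ m₂ → m₁' ≡ m₂' → e₁ ≡ e₂ → s₁ ≡ s₂ → e₁' ≡ e₂' → s₁' ≡ s₂' → k₁ ≡ k₂ →
    gapNumerator m₁ m₁' e₁ s₁ e₁' s₁' strictlyWithin gapBound m₁ m₁' k₁ →
    gapNumerator m₂ m₂' e₂ s₂ e₂' s₂' strictlyWithin gapBound m₂ m₂' k₂
  gap-cong refl refl refl refl refl refl refl within = within

  size : List I → (I → Bool) → ℤ
  size P x = ∑ P λ p → 𝟙 (x p)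

  𝟙-and-not-nonneg : ∀ a b → + 0 ≤ 𝟙 a * (+ 1 - 𝟙 b)
  𝟙-and-not-nonneg true  true  = +≤+ z≤n
  𝟙-and-not-nonneg true  false = +≤+ z≤n
  𝟙-and-not-nonneg false _     = +≤+ z≤n

  𝟙-and-not-≤ : ∀ a b → 𝟙 a * (+ 1 - 𝟙 b) ≤ 𝟙 a
  𝟙-and-not-≤ true  true  = +≤+ z≤n
  𝟙-and-not-≤ true  false = +≤+ (s≤s z≤n)
  𝟙-and-not-≤ false _     = +≤+ z≤n

  module EdgeCounts (P : List I) (x y : I → Bool) where

    m m' k k' : ℤ
    m  = size P x
    m' = size P y
    k  = ∑ P λ p → 𝟙 (x p) * (+ 1 - 𝟙 (y p))
    k' = ∑ P λ p → 𝟙 (y p) * (+ 1 - 𝟙 (x p))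

    k≤m : k ≤ m
    k≤m = ∑-mono P (λ p _ → 𝟙-and-not-≤ (x p) (y p))

    k-k' : k - k' ≡ m - m'
    k-k' = begin
      k - k'                                  ≡⟨ sym (∑-- P _ _) ⟩
      ∑ P (λ p → 𝟙 (x p) * (+ 1 - 𝟙 (y p)) - 𝟙 (y p) * (+ 1 - 𝟙 (x p)))
                                              ≡⟨ ∑-cong P (λ p → telescope (𝟙 (x p)) (𝟙 (y p))) ⟩
      ∑ P (λ p → 𝟙 (x p) - 𝟙 (y p))           ≡⟨ ∑-- P _ _ ⟩
      m - m'                                  ∎
      where
      open ≡-Reasoning
      telescope : ∀ a b → a * (+ 1 - b) - b * (+ 1 - a) ≡ a - b
      telescope = solve-∀

    k-pos : m' ≤ m → + 1 ≤ + 2 * (k + k') → + 1 ≤ k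
    k-pos m'≤m 1≤2[k+k'] = ℤP.i<j⇒suc[i]≤j (ℤP.*-cancelˡ-<-nonNeg {i = + 0} (+ 4) (ℤP.suc[i]≤j⇒i<j {i = + 0} (begin
      + 1                               ≤⟨ 1≤2[k+k'] ⟩
      + 2 * (k + k')                    ≤⟨ ℤP.i≤i+j _ (+ 2 * (m - m')) {{ℤ.nonNegative (*-nonneg (+≤+ {0} {2} z≤n) (ℤP.i≤j⇒0≤j-i m'≤m))}} ⟩
      + 2 * (k + k') + + 2 * (m - m')   ≡⟨ cong (λ d → + 2 * (k + k') + + 2 * d) (sym k-k') ⟩
      + 2 * (k + k') + + 2 * (k - k')   ≡⟨ quadruple k k' ⟩
      + 4 * k                           ∎)))
      where
      open ℤP.≤-Reasoning
      quadruple : ∀ k k' → + 2 * (k + k') + + 2 * (k - k') ≡ + 4 * k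
      quadruple = solve-∀

    k≡m : m' ≡ + 0 → k ≡ m
    k≡m m'≡0 = ℤP.≤-antisym k≤m (∑-mono P λ p p∈P → keep (x p) (y p) (absent p p∈P))
      where
      absent : ∀ p → p ∈ P → 𝟙 (y p) ≤ + 0
      absent p p∈P = subst (𝟙 (y p) ≤_) m'≡0 (term≤∑ P (λ q → 𝟙 (y q)) (λ q → 𝟙-nonneg (y q)) p∈P)
      keep : ∀ a b → 𝟙 b ≤ + 0 → 𝟙 a ≤ 𝟙 a * (+ 1 - 𝟙 b)
      keep true  false _ = +≤+ (s≤s z≤n)
      keep false false _ = +≤+ z≤n
      keep a     true  (+≤+ ())

  -- The two sums defining the modularity of a partition: inner x = Σ e(A) and
  -- volume² x = Σ vol(A)², where inn marks the pairs inside a part.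
  module Modularity (P : List I) (inn : I → Bool) (K : I → I → ℤ) where

    inner volume² : (I → Bool) → ℤ
    inner x   = ∑ P λ p → 𝟙 (x p) * 𝟙 (inn p)
    volume² x = form P K (λ p → 𝟙 (x p)) (λ p → 𝟙 (x p))

    -- A single partition of a nonempty graph has |q| < 2, i.e. the gap to the
    -- empty graph (m' = 1, e' = s' = 0 by convention) is within the bound for k = m.
    module Range (K-nonneg : ∀ p p' → + 0 ≤ K p p')
                 (K-bound  : ∀ p p' → K p p' ≤ + 2 * (+ 1 + 𝟙 (inn p)))
                 (x : I → Bool) (1≤m : + 1 ≤ size P x) where

      m : ℤ
      m = size P x

      0≤m : + 0 ≤ m
      0≤m = ℤP.≤-trans (+≤+ z≤n) 1≤m

      0≤x : ∀ p → + 0 ≤ 𝟙 (x p)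
      0≤x p = 𝟙-nonneg (x p)

      inner-nonneg : + 0 ≤ inner x
      inner-nonneg = ∑-nonneg P (λ p → *-nonneg (0≤x p) (𝟙-nonneg (inn p)))

      inner≤m : inner x ≤ m
      inner≤m = ∑-mono P λ p _ → subst (𝟙 (x p) * 𝟙 (inn p) ≤_) (ℤP.*-identityʳ (𝟙 (x p)))
                                   (ℤP.*-monoˡ-≤-nonNeg (𝟙 (x p)) {{ℤ.nonNegative (0≤x p)}} (𝟙-≤1 (inn p)))

      volume²-nonneg : + 0 ≤ volume² x
      volume²-nonneg = ∑-nonneg P λ p → ∑-nonneg P λ p' → *-nonneg (*-nonneg (0≤x p) (0≤x p')) (K-nonneg p p')

      volume²≤4m² : volume² x ≤ + 4 * (m * m)
      volume²≤4m² = ℤP.≤-trans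
        (∑-mono P λ p _ → ∑-mono P λ p' _ →
           ℤP.*-monoˡ-≤-nonNeg (𝟙 (x p) * 𝟙 (x p')) {{ℤ.nonNegative (*-nonneg (0≤x p) (0≤x p'))}} (K≤4 p p'))
        (ℤP.≤-reflexive (form-const P (+ 4) (λ p → 𝟙 (x p)) (λ p → 𝟙 (x p))))
        where
        K≤4 : ∀ p p' → K p p' ≤ + 4
        K≤4 p p' = ℤP.≤-trans (K-bound p p') (ℤP.*-monoˡ-≤-nonNeg (+ 2) (ℤP.+-monoʳ-≤ (+ 1) (𝟙-≤1 (inn p))))

      range : gapNumerator m (+ 1) (inner x) (volume² x) (+ 0) (+ 0) strictlyWithin gapBound m (+ 1) m
      range = ℤP.≤-<-trans above 4m²<bound , ℤP.≤-<-trans below 4m²<bound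
        where
        open ℤP.≤-Reasoning
        4m≥0 : + 0 ≤ + 4 * m
        4m≥0 = *-nonneg (+≤+ {0} {4} z≤n) 0≤m
        simplify : ∀ m e s → + 4 * m * + 1 * + 1 * e - + 1 * + 1 * s - (+ 4 * m * m * + 1 * + 0 - m * m * + 0)
                           ≡ + 4 * m * e - s
        simplify = solve-∀
        above : gapNumerator m (+ 1) (inner x) (volume² x) (+ 0) (+ 0) ≤ + 4 * (m * m)
        above = begin
          gapNumerator m (+ 1) (inner x) (volume² x) (+ 0) (+ 0) ≡⟨ simplify m (inner x) (volume² x) ⟩
          + 4 * m * inner x - volume² x  ≤⟨ ℤP.i≤j⇒i-k≤j (volume² x) {{ℤ.nonNegative volume²-nonneg}}
                                              (ℤP.*-monoˡ-≤-nonNeg (+ 4 * m) {{ℤ.nonNegative 4m≥0}} inner≤m) ⟩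
          + 4 * m * m                    ≡⟨ ℤP.*-assoc (+ 4) m m ⟩
          + 4 * (m * m)                  ∎
        below : - gapNumerator m (+ 1) (inner x) (volume² x) (+ 0) (+ 0) ≤ + 4 * (m * m)
        below = begin
          - gapNumerator m (+ 1) (inner x) (volume² x) (+ 0) (+ 0) ≡⟨ cong -_ (simplify m (inner x) (volume² x)) ⟩
          - (+ 4 * m * inner x - volume² x)  ≡⟨ neg-difference (+ 4 * m * inner x) (volume² x) ⟩
          volume² x - + 4 * m * inner x      ≤⟨ ℤP.i≤j⇒i-k≤j (+ 4 * m * inner x) {{ℤ.nonNegative (*-nonneg 4m≥0 inner-nonneg)}} volume²≤4m² ⟩
          + 4 * (m * m)                      ∎
          where
          neg-difference : ∀ a b → - (a - b) ≡ b - a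
          neg-difference = solve-∀
        4m²<bound : + 4 * (m * m) < gapBound m (+ 1) m
        4m²<bound = <-by-difference (+ 4 * (m * m)) (difference m) (ℤP.≤-trans (+≤+ (s≤s z≤n)) (ℤP.*-monoˡ-≤-nonNeg (+ 4) (1≤* 1≤m 1≤m)))
          where
          difference : ∀ m → + 8 * m * + 1 * + 1 * m - + 4 * (m * m) ≡ + 4 * (m * m)
          difference = solve-∀

  module ModularityGap (P : List I) (inn : I → Bool) (K : I → I → ℤ) (x y : I → Bool) where

    open EdgeCounts P x y public
    open Modularity P inn K

    e e' s s' : ℤ
    e  = inner x
    e' = inner y
    s  = volume² x
    s' = volume² y

    -- Rescaled edge weights X = m'·x and Y = m·y have equal total mass m m';
    -- D = X − Y is the signed change, W(p) the potential of X + Y at p, and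
    -- g(p) the coefficient with which D(p) enters the numerator.
    M : ℤ
    M = m * m'

    X Y D W g : I → ℤ
    X p = m' * 𝟙 (x p)
    Y p = m * 𝟙 (y p)
    D p = X p - Y p
    W p = ∑ P λ p' → K p p' * (X p' + Y p')
    g p = + 4 * M * (+ 1 + 𝟙 (inn p)) - W p

    ∑D≡0 : ∑ P D ≡ + 0
    ∑D≡0 = begin
      ∑ P D                   ≡⟨ ∑-- P X Y ⟩
      ∑ P X - ∑ P Y           ≡⟨ cong₂ _-_ (∑-*ˡ P m' _) (∑-*ˡ P m _) ⟩
      m' * m - m * m'         ≡⟨ cong (_- m * m') (ℤP.*-comm m' m) ⟩
      m * m' - m * m'         ≡⟨ ℤP.+-inverseʳ (m * m') ⟩
      + 0                     ∎
      where open ≡-Reasoning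

    ∑inn·D : ∑ P (λ p → 𝟙 (inn p) * D p) ≡ m' * e - m * e'
    ∑inn·D = trans (∑-cong P λ p → distribute (𝟙 (inn p)) (𝟙 (x p)) (𝟙 (y p)) m m')
                   (trans (∑-- P _ _) (cong₂ _-_ (∑-*ˡ P m' _) (∑-*ˡ P m _)))
      where
      distribute : ∀ i a b c c' → i * (c' * a - c * b) ≡ c' * (a * i) - c * (b * i)
      distribute = solve-∀

    module _ (K-sym : ∀ p p' → K p p' ≡ K p' p) where

      ∑W·D : ∑ P (λ p → W p * D p) ≡ m' * m' * s - m * m * s'
      ∑W·D = begin
        ∑ P (λ p → W p * D p)                                 ≡⟨ form-potential P K D (λ p → X p + Y p) ⟩
        form P K D (λ p → X p + Y p)                          ≡⟨ form-difference-of-squares P K K-sym X Y ⟩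
        form P K X X - form P K Y Y                           ≡⟨ cong₂ _-_ (form-scale P K m' m' _ _) (form-scale P K m m _ _) ⟩
        m' * m' * s - m * m * s'                              ∎
        where open ≡-Reasoning

      gap-as-sum : gapNumerator m m' e s e' s' ≡ ∑ P (λ p → g p * D p)
      gap-as-sum = sym (begin
        ∑ P (λ p → g p * D p)
          ≡⟨ ∑-cong P (λ p → expand M (𝟙 (inn p)) (W p) (D p)) ⟩
        ∑ P (λ p → + 4 * M * D p + + 4 * M * (𝟙 (inn p) * D p) - W p * D p)
          ≡⟨ ∑-- P (λ p → + 4 * M * D p + + 4 * M * (𝟙 (inn p) * D p)) (λ p → W p * D p) ⟩
        ∑ P (λ p → + 4 * M * D p + + 4 * M * (𝟙 (inn p) * D p)) - ∑ P (λ p → W p * D p)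
          ≡⟨ cong (_- ∑ P (λ p → W p * D p)) (trans (∑-+ P (λ p → + 4 * M * D p) (λ p → + 4 * M * (𝟙 (inn p) * D p)))
                                                    (cong₂ _+_ (∑-*ˡ P (+ 4 * M) D) (∑-*ˡ P (+ 4 * M) (λ p → 𝟙 (inn p) * D p)))) ⟩
        + 4 * M * ∑ P D + + 4 * M * ∑ P (λ p → 𝟙 (inn p) * D p) - ∑ P (λ p → W p * D p)
          ≡⟨ cong₂ (λ z w → + 4 * M * z + + 4 * M * w - ∑ P (λ p → W p * D p)) ∑D≡0 ∑inn·D ⟩
        + 4 * M * + 0 + + 4 * M * (m' * e - m * e') - ∑ P (λ p → W p * D p)
          ≡⟨ cong (λ z → + 4 * M * + 0 + + 4 * M * (m' * e - m * e') - z) ∑W·D ⟩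
        + 4 * M * + 0 + + 4 * M * (m' * e - m * e') - (m' * m' * s - m * m * s')
          ≡⟨ collect m m' e s e' s' ⟩
        gapNumerator m m' e s e' s' ∎)
        where
        open ≡-Reasoning
        expand : ∀ μ i w d → (+ 4 * μ * (+ 1 + i) - w) * d ≡ + 4 * μ * d + + 4 * μ * (i * d) - w * d
        expand = solve-∀
        collect : ∀ m m' e s e' s' → + 4 * (m * m') * + 0 + + 4 * (m * m') * (m' * e - m * e') - (m' * m' * s - m * m * s')
                                   ≡ + 4 * m * m' * m' * e - m' * m' * s - (+ 4 * m * m * m' * e' - m * m * s')
        collect = solve-∀

    module Bounds (K-sym    : ∀ p p' → K p p' ≡ K p' p)
                  (K-nonneg : ∀ p p' → + 0 ≤ K p p')
                  (K-diag   : ∀ p → + 1 ≤ K p p)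
                  (K-bound  : ∀ p p' → K p p' ≤ + 2 * (+ 1 + 𝟙 (inn p)))
                  (1≤m'     : + 1 ≤ m')
                  (m'≤m     : m' ≤ m)
                  (1≤k      : + 1 ≤ k) where

      open ℤP.≤-Reasoning

      0≤m' : + 0 ≤ m'
      0≤m' = ℤP.≤-trans (+≤+ z≤n) 1≤m'

      0≤m : + 0 ≤ m
      0≤m = ℤP.≤-trans 0≤m' m'≤m

      0≤M : + 0 ≤ M
      0≤M = *-nonneg 0≤m 0≤m'

      0≤X+Y : ∀ p → + 0 ≤ X p + Y p
      0≤X+Y p = ℤP.+-mono-≤ (*-nonneg 0≤m' (𝟙-nonneg (x p))) (*-nonneg 0≤m (𝟙-nonneg (y p)))

      ∑X+Y : ∑ P (λ p → X p + Y p) ≡ + 2 * M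
      ∑X+Y = trans (∑-+ P X Y) (trans (cong₂ _+_ (∑-*ˡ P m' _) (∑-*ˡ P m _)) (double m m'))
        where
        double : ∀ m m' → m' * m + m * m' ≡ + 2 * (m * m')
        double = solve-∀

      W-bound : ∀ p → W p ≤ + 4 * M * (+ 1 + 𝟙 (inn p))
      W-bound p = begin
        W p                                                ≤⟨ ∑-mono P (λ p' _ → ℤP.*-monoʳ-≤-nonNeg (X p' + Y p') {{ℤ.nonNegative (0≤X+Y p')}} (K-bound p p')) ⟩
        ∑ P (λ p' → + 2 * (+ 1 + 𝟙 (inn p)) * (X p' + Y p')) ≡⟨ ∑-*ˡ P (+ 2 * (+ 1 + 𝟙 (inn p))) (λ p' → X p' + Y p') ⟩
        + 2 * (+ 1 + 𝟙 (inn p)) * ∑ P (λ p' → X p' + Y p')   ≡⟨ cong (+ 2 * (+ 1 + 𝟙 (inn p)) *_) ∑X+Y ⟩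
        + 2 * (+ 1 + 𝟙 (inn p)) * (+ 2 * M)                 ≡⟨ regroup M (𝟙 (inn p)) ⟩
        + 4 * M * (+ 1 + 𝟙 (inn p))                         ∎
        where
        regroup : ∀ μ i → + 2 * (+ 1 + i) * (+ 2 * μ) ≡ + 4 * μ * (+ 1 + i)
        regroup = solve-∀

      g-nonneg : ∀ p → + 0 ≤ g p
      g-nonneg p = ℤP.i≤j⇒0≤j-i (W-bound p)

      mass-pos : ∀ p → x p ≡ true ⊎ y p ≡ true → + 1 ≤ m' * 𝟙 (x p) + m * 𝟙 (y p)
      mass-pos p (inj₁ xp) rewrite xp =
        ℤP.≤-trans 1≤m' (ℤP.≤-trans (ℤP.≤-reflexive (sym (ℤP.*-identityʳ m')))
                                    (ℤP.i≤i+j (m' * + 1) _ {{ℤ.nonNegative (*-nonneg 0≤m (𝟙-nonneg (y p)))}}))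
      mass-pos p (inj₂ yp) rewrite yp =
        ℤP.≤-trans (ℤP.≤-trans 1≤m' m'≤m) (ℤP.≤-trans (ℤP.≤-reflexive (sym (ℤP.*-identityʳ m)))
                                    (ℤP.i≤j+i (m * + 1) _ {{ℤ.nonNegative (*-nonneg 0≤m' (𝟙-nonneg (x p)))}}))

      C : ℤ
      C = + 8 * M - + 1

      g≤C : ∀ p → p ∈ P → x p ≡ true ⊎ y p ≡ true → g p ≤ C
      g≤C p p∈P edge = ℤP.+-mono-≤ first (ℤP.neg-mono-≤ 1≤W)
        where
        first : + 4 * M * (+ 1 + 𝟙 (inn p)) ≤ + 8 * M
        first = begin
          + 4 * M * (+ 1 + 𝟙 (inn p)) ≤⟨ ℤP.*-monoˡ-≤-nonNeg (+ 4 * M) {{ℤ.nonNegative (*-nonneg (+≤+ {0} {4} z≤n) 0≤M)}}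
                                           (ℤP.+-monoʳ-≤ (+ 1) (𝟙-≤1 (inn p))) ⟩
          + 4 * M * + 2                ≡⟨ ℤP.*-comm (+ 4 * M) (+ 2) ⟩
          + 2 * (+ 4 * M)              ≡⟨ sym (ℤP.*-assoc (+ 2) (+ 4) M) ⟩
          + 8 * M                      ∎
        1≤W : + 1 ≤ W p
        1≤W = ℤP.≤-trans (1≤* (K-diag p) (mass-pos p edge))
                         (term≤∑ P (λ p' → K p p' * (X p' + Y p')) (λ p' → *-nonneg (K-nonneg p p') (0≤X+Y p')) p∈P)

      -- D = u − r splits the change at p into a gain u ≥ 0 (an edge of x not in y,
      -- weighted m') and a loss r ≥ 0 (an edge of y, weighted m − m'·x).
      u r : I → ℤ
      u p = m' * (𝟙 (x p) * (+ 1 - 𝟙 (y p)))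
      r p = 𝟙 (y p) * (m - 𝟙 (x p) * m')

      D-split : ∀ p → D p ≡ u p - r p
      D-split p = split (𝟙 (x p)) (𝟙 (y p)) m m'
        where
        split : ∀ a b m m' → m' * a - m * b ≡ m' * (a * (+ 1 - b)) - b * (m - a * m')
        split = solve-∀

      u-nonneg : ∀ p → + 0 ≤ u p
      u-nonneg p = *-nonneg 0≤m' (𝟙-and-not-nonneg (x p) (y p))

      r-nonneg : ∀ p → + 0 ≤ r p
      r-nonneg p = *-nonneg (𝟙-nonneg (y p)) (ℤP.i≤j⇒0≤j-i (begin
        𝟙 (x p) * m' ≤⟨ ℤP.*-monoʳ-≤-nonNeg m' {{ℤ.nonNegative 0≤m'}} (𝟙-≤1 (x p)) ⟩
        + 1 * m'     ≡⟨ ℤP.*-identityˡ m' ⟩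
        m'           ≤⟨ m'≤m ⟩
        m            ∎))

      u-vanishes : ∀ p → x p ≡ false → m' * (𝟙 (x p) * (+ 1 - 𝟙 (y p))) ≡ + 0
      u-vanishes p xp rewrite xp = ℤP.*-zeroʳ m'

      r-vanishes : ∀ p → y p ≡ false → 𝟙 (y p) * (m - 𝟙 (x p) * m') ≡ + 0
      r-vanishes p yp rewrite yp = refl

      g·u≤C·u : ∀ p → p ∈ P → g p * u p ≤ C * u p
      g·u≤C·u p p∈P with bit-cases (x p)
      ... | inj₁ xp = scaled≤ (u-nonneg p) (g≤C p p∈P (inj₁ xp))
      ... | inj₂ xp = vanishing (u-vanishes p xp) (g p) C

      g·r≤C·r : ∀ p → p ∈ P → g p * r p ≤ C * r p
      g·r≤C·r p p∈P with bit-cases (y p)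
      ... | inj₁ yp = scaled≤ (r-nonneg p) (g≤C p p∈P (inj₂ yp))
      ... | inj₂ yp = vanishing (r-vanishes p yp) (g p) C

      pointwise : ∀ p → p ∈ P → g p * D p ≤ C * u p × - (C * r p) ≤ g p * D p
      pointwise p p∈P rewrite D-split p =
        bracket C (g-nonneg p) (u-nonneg p) (r-nonneg p) (g·u≤C·u p p∈P) (g·r≤C·r p p∈P)

      ∑u : ∑ P u ≡ m' * k
      ∑u = ∑-*ˡ P m' _

      ∑r : ∑ P r ≡ m' * k
      ∑r = begin-equality
        ∑ P r                  ≡⟨ ∑-cong P (λ p → trans (solve-r (u p) (r p)) (cong (_-_ (u p)) (sym (D-split p)))) ⟩
        ∑ P (λ p → u p - D p)  ≡⟨ ∑-- P u D ⟩
        ∑ P u - ∑ P D          ≡⟨ cong₂ _-_ ∑u ∑D≡0 ⟩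
        m' * k - + 0           ≡⟨ ℤP.+-identityʳ (m' * k) ⟩
        m' * k                 ∎
        where
        solve-r : ∀ u r → r ≡ u - (u - r)
        solve-r = solve-∀

      C·m'k<bound : C * (m' * k) < gapBound m m' k
      C·m'k<bound = <-by-difference (m' * k) (difference m m' k) (1≤* 1≤m' 1≤k)
        where
        difference : ∀ m m' k → + 8 * m * m' * m' * k - (+ 8 * (m * m') - + 1) * (m' * k) ≡ m' * k
        difference = solve-∀

      gap-bounded : gapNumerator m m' e s e' s' strictlyWithin gapBound m m' k
      gap-bounded = ℤP.≤-<-trans above C·m'k<bound , ℤP.≤-<-trans below C·m'k<bound
        where
        above : gapNumerator m m' e s e' s' ≤ C * (m' * k)
        above = begin
          gapNumerator m m' e s e' s' ≡⟨ gap-as-sum K-sym ⟩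
          ∑ P (λ p → g p * D p)       ≤⟨ ∑-mono P (λ p p∈P → proj₁ (pointwise p p∈P)) ⟩
          ∑ P (λ p → C * u p)         ≡⟨ ∑-*ˡ P C u ⟩
          C * ∑ P u                   ≡⟨ cong (C *_) ∑u ⟩
          C * (m' * k)                ∎
        below : - gapNumerator m m' e s e' s' ≤ C * (m' * k)
        below = begin
          - gapNumerator m m' e s e' s' ≡⟨ cong -_ (gap-as-sum K-sym) ⟩
          - ∑ P (λ p → g p * D p)       ≤⟨ ℤP.neg-mono-≤ (∑-mono P (λ p p∈P → proj₂ (pointwise p p∈P))) ⟩
          - ∑ P (λ p → - (C * r p))     ≡⟨ cong -_ (∑-neg P (λ p → C * r p)) ⟩
          - - ∑ P (λ p → C * r p)       ≡⟨ ℤP.neg-involutive _ ⟩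
          ∑ P (λ p → C * r p)           ≡⟨ ∑-*ˡ P C r ⟩
          C * ∑ P r                     ≡⟨ cong (C *_) ∑r ⟩
          C * (m' * k)                  ∎


module GraphData where

  open import Data.Bool using (Bool; true; false; _∧_; not; if_then_else_)
  open import Data.Fin as Fin using (Fin; zero; suc; toℕ; _≟_)
  import Data.Fin.Properties as FinP
  open import Data.Integer as ℤ using (ℤ; +_; _+_; _*_; _-_; _≤_; +≤+)
  import Data.Integer.Properties as ℤP
  open import Data.Integer.Tactic.RingSolver using (solve-∀)
  open import Data.List using (List; []; _∷_; map; tabulate; allFin)
  open import Data.Nat.ListAction using (sum)
  open import Data.Nat as ℕ using (ℕ; _<ᵇ_; z≤n; s≤s)
  import Data.Nat.Properties as ℕP
  open import Data.Product using (Σ; _×_; _,_; proj₁; proj₂)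
  open import Data.Vec using (lookup)
  open import Function using (_∘_)
  open import Relation.Binary.Definitions using (tri<; tri≈; tri>)
  open import Relation.Binary.PropositionalEquality
  open import Relation.Nullary.Decidable using (⌊_⌋; yes; no; dec-true; dec-false; isYes≗does; ⌊⌋-map′)
  open import Relation.Nullary.Negation using (¬_; contradiction)
  open import Data.List.Membership.Propositional.Properties using (∈-allFin)
  open import Defs hiding (sym)
  open IntegerSums
  open AbstractModularity

  private variable A : Set

  count-as-∑ : ∀ (p : A → Bool) xs → + count p xs ≡ ∑ xs (λ a → 𝟙 (p a))
  count-as-∑ p xs = trans (sum-as-∑ xs _) (∑-cong xs λ a → indicator (p a))
    where
    indicator : ∀ b → + (if b then 1 else 0) ≡ 𝟙 b
    indicator true  = refl
    indicator false = refl

  𝟙-∧ : ∀ a b → 𝟙 (a ∧ b) ≡ 𝟙 a * 𝟙 b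
  𝟙-∧ true  b = sym (ℤP.*-identityˡ (𝟙 b))
  𝟙-∧ false b = refl

  𝟙-∧-not : ∀ a b → 𝟙 (a ∧ not b) ≡ 𝟙 a * (+ 1 - 𝟙 b)
  𝟙-∧-not true  true  = refl
  𝟙-∧-not true  false = refl
  𝟙-∧-not false b     = refl

  ∑-tabulate : ∀ n (h : Fin n → A) F → ∑ (tabulate h) F ≡ ∑ (allFin n) (F ∘ h)
  ∑-tabulate ℕ.zero    h F = refl
  ∑-tabulate (ℕ.suc n) h F = cong (_+_ (F (h zero))) (trans (∑-tabulate n (h ∘ suc) F) (sym (∑-tabulate n suc (F ∘ h))))

  ∑-allFin-suc : ∀ n (F : Fin (ℕ.suc n) → ℤ) → ∑ (allFin (ℕ.suc n)) F ≡ F zero + ∑ (allFin n) (F ∘ suc)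
  ∑-allFin-suc n F = cong (_+_ (F zero)) (∑-tabulate n suc F)

  ∑-delta : ∀ n (a : Fin n) (h : Fin n → ℤ) → ∑ (allFin n) (λ k → 𝟙 ⌊ a ≟ k ⌋ * h k) ≡ h a
  ∑-delta (ℕ.suc n) zero    h = begin
    ∑ (allFin (ℕ.suc n)) (λ k → 𝟙 ⌊ zero ≟ k ⌋ * h k)  ≡⟨ ∑-allFin-suc n (λ k → 𝟙 ⌊ zero ≟ k ⌋ * h k) ⟩
    + 1 * h zero + ∑ (allFin n) (λ _ → + 0)           ≡⟨ cong₂ _+_ (ℤP.*-identityˡ (h zero)) (∑-zero (allFin n)) ⟩
    h zero + + 0                                      ≡⟨ ℤP.+-identityʳ (h zero) ⟩
    h zero                                            ∎
    where open ≡-Reasoning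
  ∑-delta (ℕ.suc n) (suc a) h = begin
    ∑ (allFin (ℕ.suc n)) (λ k → 𝟙 ⌊ suc a ≟ k ⌋ * h k)       ≡⟨ ∑-allFin-suc n (λ k → 𝟙 ⌊ suc a ≟ k ⌋ * h k) ⟩
    + 0 + ∑ (allFin n) (λ k → 𝟙 ⌊ suc a ≟ suc k ⌋ * h (suc k)) ≡⟨ ℤP.+-identityˡ _ ⟩
    ∑ (allFin n) (λ k → 𝟙 ⌊ suc a ≟ suc k ⌋ * h (suc k))       ≡⟨ ∑-cong (allFin n) (λ k → cong (λ b → 𝟙 b * h (suc k)) (⌊⌋-map′ (cong suc) FinP.suc-injective (a ≟ k))) ⟩
    ∑ (allFin n) (λ k → 𝟙 ⌊ a ≟ k ⌋ * h (suc k))               ≡⟨ ∑-delta n a (h ∘ suc) ⟩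
    h (suc a)                                                  ∎
    where open ≡-Reasoning

  before : ∀ {n} → Fin n → Fin n → Bool
  before i j = toℕ i <ᵇ toℕ j

  ∑-pairs : ∀ n F → ∑ (pairs n) F ≡ ∑ (allFin n) (λ i → ∑ (allFin n) (λ j → 𝟙 (before i j) * F (i , j)))
  ∑-pairs n F = trans (∑-concatMap _ (allFin n) F) (∑-cong (allFin n) λ i →
                trans (∑-concatMap _ (allFin n) F) (∑-cong (allFin n) λ j → ∑-optional (before i j) (i , j)))
    where
    ∑-optional : ∀ b p → ∑ (if b then p ∷ [] else []) F ≡ 𝟙 b * F p
    ∑-optional true  p = trans (ℤP.+-identityʳ (F p)) (sym (ℤP.*-identityˡ (F p)))
    ∑-optional false p = refl

  before-true : ∀ {n} {i j : Fin n} → toℕ i ℕ.< toℕ j → before i j ≡ true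
  before-true {i = i} {j} = dec-true (toℕ i ℕP.<? toℕ j)

  before-false : ∀ {n} {i j : Fin n} → ¬ toℕ i ℕ.< toℕ j → before i j ≡ false
  before-false {i = i} {j} = dec-false (toℕ i ℕP.<? toℕ j)

  either-order : ∀ {n} (F : Fin n → Fin n → ℤ) → (∀ i → F i i ≡ + 0) → ∀ i j →
                 𝟙 (before i j) * F i j + 𝟙 (before j i) * F i j ≡ F i j
  either-order F diag i j with ℕP.<-cmp (toℕ i) (toℕ j)
  ... | tri< i<j _ j≮i rewrite before-true i<j | before-false j≮i =
    trans (ℤP.+-identityʳ (+ 1 * F i j)) (ℤP.*-identityˡ (F i j))
  ... | tri> i≮j _ j<i rewrite before-false i≮j | before-true j<i =
    trans (ℤP.+-identityˡ (+ 1 * F i j)) (ℤP.*-identityˡ (F i j))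
  ... | tri≈ _ i≡j _ with FinP.toℕ-injective i≡j
  ...   | refl rewrite diag i | before-false (ℕP.<-irrefl {toℕ i} refl) = refl

  ∑-offdiagonal : ∀ n (F : Fin n → Fin n → ℤ) → (∀ i → F i i ≡ + 0) →
    ∑ (allFin n) (λ i → ∑ (allFin n) (F i)) ≡ ∑ (pairs n) (λ p → F (proj₁ p) (proj₂ p) + F (proj₂ p) (proj₁ p))
  ∑-offdiagonal n F diag = sym (begin
    ∑ (pairs n) (λ p → F (proj₁ p) (proj₂ p) + F (proj₂ p) (proj₁ p))
      ≡⟨ ∑-pairs n _ ⟩
    ∑² (λ i j → 𝟙 (before i j) * (F i j + F j i))
      ≡⟨ ∑-cong L (λ i → ∑-cong L λ j → ℤP.*-distribˡ-+ (𝟙 (before i j)) (F i j) (F j i)) ⟩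
    ∑² (λ i j → 𝟙 (before i j) * F i j + 𝟙 (before i j) * F j i)
      ≡⟨ ∑²-+ _ _ ⟩
    ∑² (λ i j → 𝟙 (before i j) * F i j) + ∑² (λ i j → 𝟙 (before i j) * F j i)
      ≡⟨ cong (_+_ (∑² (λ i j → 𝟙 (before i j) * F i j))) (∑-swap L L (λ i j → 𝟙 (before i j) * F j i)) ⟩
    ∑² (λ i j → 𝟙 (before i j) * F i j) + ∑² (λ i j → 𝟙 (before j i) * F i j)
      ≡⟨ sym (∑²-+ _ _) ⟩
    ∑² (λ i j → 𝟙 (before i j) * F i j + 𝟙 (before j i) * F i j)
      ≡⟨ ∑-cong L (λ i → ∑-cong L λ j → either-order F diag i j) ⟩
    ∑² F ∎)
    where
    open ≡-Reasoning
    L = allFin n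
    ∑² : (Fin n → Fin n → ℤ) → ℤ
    ∑² G = ∑ L (λ i → ∑ L (G i))
    ∑²-+ : ∀ G H → ∑² (λ i j → G i j + H i j) ≡ ∑² G + ∑² H
    ∑²-+ G H = trans (∑-cong L (λ i → ∑-+ L (G i) (H i))) (∑-+ L _ _)

  Pair : ℕ → Set
  Pair n = Fin n × Fin n

  edge : ∀ {n} → Graph n → Pair n → Bool
  edge H p = adj H (proj₁ p) (proj₂ p)

  sameSide : ∀ {n} → Labelling n → Pair n → Bool
  sameSide f p = inPart f (lookup f (proj₁ p)) (proj₂ p)

  charge : ∀ {n} → Labelling n → Fin n → Pair n → ℤ
  charge f k p = 𝟙 (inPart f k (proj₁ p)) + 𝟙 (inPart f k (proj₂ p))

  -- kernel f p p' = Σ_k charge_k(p) charge_k(p'); then Σ_k vol(A_k)² = ⟨x , x⟩.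
  kernel : ∀ {n} → Labelling n → Pair n → Pair n → ℤ
  kernel {n} f p p' = ∑ (allFin n) (λ k → charge f k p * charge f k p')

  module _ {n : ℕ} where

    private
      P = pairs n
      L = allFin n

    numEdges-as-∑ : ∀ (H : Graph n) → + numEdges H ≡ ∑ P (λ p → 𝟙 (edge H p))
    numEdges-as-∑ H = count-as-∑ _ P

    edgeDiff-as-∑ : ∀ (G G' : Graph n) → + edgeDiff G G' ≡ ∑ P (λ p → 𝟙 (edge G p) * (+ 1 - 𝟙 (edge G' p)))
    edgeDiff-as-∑ G G' = trans (count-as-∑ _ P) (∑-cong P λ p → 𝟙-∧-not (edge G p) (edge G' p))

    module _ (H : Graph n) (f : Labelling n) where

      inner-edges-as-∑ : + sum (map (eIn H f) L) ≡ ∑ P (λ p → 𝟙 (edge H p) * 𝟙 (sameSide f p))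
      inner-edges-as-∑ = begin
        + sum (map (eIn H f) L)
          ≡⟨ sum-as-∑ L (eIn H f) ⟩
        ∑ L (λ k → + eIn H f k)
          ≡⟨ ∑-cong L (λ k → trans (count-as-∑ _ P) (∑-cong P λ p → both-ends k p)) ⟩
        ∑ L (λ k → ∑ P (λ p → 𝟙 (edge H p) * (𝟙 (inPart f k (proj₁ p)) * 𝟙 (inPart f k (proj₂ p)))))
          ≡⟨ ∑-swap L P _ ⟩
        ∑ P (λ p → ∑ L (λ k → 𝟙 (edge H p) * (𝟙 (inPart f k (proj₁ p)) * 𝟙 (inPart f k (proj₂ p)))))
          ≡⟨ ∑-cong P (λ p → trans (∑-*ˡ L (𝟙 (edge H p)) _)
                                   (cong (𝟙 (edge H p) *_) (∑-delta n (lookup f (proj₁ p)) (λ k → 𝟙 (inPart f k (proj₂ p)))))) ⟩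
        ∑ P (λ p → 𝟙 (edge H p) * 𝟙 (sameSide f p)) ∎
        where
        open ≡-Reasoning
        both-ends : ∀ k p → 𝟙 (edge H p ∧ (inPart f k (proj₁ p) ∧ inPart f k (proj₂ p)))
                          ≡ 𝟙 (edge H p) * (𝟙 (inPart f k (proj₁ p)) * 𝟙 (inPart f k (proj₂ p)))
        both-ends k p = trans (𝟙-∧ (edge H p) _) (cong (𝟙 (edge H p) *_) (𝟙-∧ (inPart f k (proj₁ p)) _))

      vol-as-∑ : ∀ k → + vol H f k ≡ ∑ P (λ p → 𝟙 (edge H p) * charge f k p)
      vol-as-∑ k = begin
        + vol H f k
          ≡⟨ sum-as-∑ L _ ⟩
        ∑ L (λ i → + (if inPart f k i then deg H i else 0))
          ≡⟨ ∑-cong L (λ i → trans (weighted (inPart f k i) (deg H i)) (cong (𝟙 (inPart f k i) *_) (count-as-∑ (adj H i) L))) ⟩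
        ∑ L (λ i → 𝟙 (inPart f k i) * ∑ L (λ j → 𝟙 (adj H i j)))
          ≡⟨ ∑-cong L (λ i → sym (∑-*ˡ L (𝟙 (inPart f k i)) _)) ⟩
        ∑ L (λ i → ∑ L (λ j → 𝟙 (inPart f k i) * 𝟙 (adj H i j)))
          ≡⟨ ∑-offdiagonal n (λ i j → 𝟙 (inPart f k i) * 𝟙 (adj H i j)) loopless ⟩
        ∑ P (λ p → 𝟙 (inPart f k (proj₁ p)) * 𝟙 (edge H p) + 𝟙 (inPart f k (proj₂ p)) * 𝟙 (adj H (proj₂ p) (proj₁ p)))
          ≡⟨ ∑-cong P (λ p → trans (cong (λ b → 𝟙 (inPart f k (proj₁ p)) * 𝟙 (edge H p) + 𝟙 (inPart f k (proj₂ p)) * 𝟙 b)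
                                          (Graph.sym H (proj₂ p) (proj₁ p)))
                                    (collect (𝟙 (inPart f k (proj₁ p))) (𝟙 (inPart f k (proj₂ p))) (𝟙 (edge H p)))) ⟩
        ∑ P (λ p → 𝟙 (edge H p) * charge f k p) ∎
        where
        open ≡-Reasoning
        weighted : ∀ b d → + (if b then d else 0) ≡ 𝟙 b * + d
        weighted true  d = sym (ℤP.*-identityˡ (+ d))
        weighted false d = refl
        loopless : ∀ i → 𝟙 (inPart f k i) * 𝟙 (adj H i i) ≡ + 0
        loopless i rewrite irrefl H i = ℤP.*-zeroʳ (𝟙 (inPart f k i))
        collect : ∀ a b e → a * e + b * e ≡ e * (a + b)
        collect = solve-∀

      vol²-as-form : + sum (map (λ k → vol H f k ℕ.* vol H f k) L)
                   ≡ form P (kernel f) (λ p → 𝟙 (edge H p)) (λ p → 𝟙 (edge H p))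
      vol²-as-form = begin
        + sum (map (λ k → vol H f k ℕ.* vol H f k) L)
          ≡⟨ sum-as-∑ L _ ⟩
        ∑ L (λ k → + (vol H f k ℕ.* vol H f k))
          ≡⟨ ∑-cong L (λ k → trans (ℤP.pos-* (vol H f k) (vol H f k)) (cong₂ _*_ (vol-as-∑ k) (vol-as-∑ k))) ⟩
        ∑ L (λ k → ∑ P (λ p → x p * charge f k p) * ∑ P (λ p' → x p' * charge f k p'))
          ≡⟨ ∑-cong L (λ k → ∑-product P P _ _) ⟩
        ∑ L (λ k → ∑ P (λ p → ∑ P (λ p' → x p * charge f k p * (x p' * charge f k p'))))
          ≡⟨ trans (∑-swap L P _) (∑-cong P λ p → ∑-swap L P _) ⟩
        ∑ P (λ p → ∑ P (λ p' → ∑ L (λ k → x p * charge f k p * (x p' * charge f k p'))))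
          ≡⟨ ∑-cong P (λ p → ∑-cong P λ p' → trans (∑-cong L λ k → regroup (x p) (x p') (charge f k p) (charge f k p'))
                                                   (∑-*ˡ L (x p * x p') _)) ⟩
        form P (kernel f) x x ∎
        where
        open ≡-Reasoning
        x : Pair n → ℤ
        x p = 𝟙 (edge H p)
        regroup : ∀ a b c d → a * c * (b * d) ≡ a * b * (c * d)
        regroup = solve-∀

  ⌊≟⌋-true : ∀ {n} {a b : Fin n} → a ≡ b → ⌊ a ≟ b ⌋ ≡ true
  ⌊≟⌋-true {a = a} {b} a≡b = trans (isYes≗does (a ≟ b)) (dec-true (a ≟ b) a≡b)

  ⌊≟⌋-false : ∀ {n} {a b : Fin n} → a ≢ b → ⌊ a ≟ b ⌋ ≡ false
  ⌊≟⌋-false {a = a} {b} a≢b = trans (isYes≗does (a ≟ b)) (dec-false (a ≟ b) a≢b)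

  at-most-one : ∀ {n} {a b : Fin n} → a ≢ b → ∀ u → 𝟙 ⌊ u ≟ a ⌋ + 𝟙 ⌊ u ≟ b ⌋ ≤ + 1
  at-most-one {a = a} {b} a≢b u with u ≟ a
  ... | yes refl rewrite ⌊≟⌋-false a≢b = +≤+ (s≤s z≤n)
  ... | no _     = ℤP.≤-trans (ℤP.≤-reflexive (ℤP.+-identityˡ _)) (𝟙-≤1 ⌊ u ≟ b ⌋)

  meetings-bound : ∀ {n} (a b u v : Fin n) →
    (𝟙 ⌊ u ≟ a ⌋ + 𝟙 ⌊ v ≟ a ⌋) + (𝟙 ⌊ u ≟ b ⌋ + 𝟙 ⌊ v ≟ b ⌋) ≤ + 2 * (+ 1 + 𝟙 ⌊ b ≟ a ⌋)
  meetings-bound a b u v with b ≟ a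
  ... | yes _ = ℤP.+-mono-≤ (ℤP.+-mono-≤ (𝟙-≤1 ⌊ u ≟ a ⌋) (𝟙-≤1 ⌊ v ≟ a ⌋)) (ℤP.+-mono-≤ (𝟙-≤1 ⌊ u ≟ b ⌋) (𝟙-≤1 ⌊ v ≟ b ⌋))
  ... | no b≢a = ℤP.≤-trans (ℤP.≤-reflexive (interchange (𝟙 ⌊ u ≟ a ⌋) (𝟙 ⌊ v ≟ a ⌋) (𝟙 ⌊ u ≟ b ⌋) (𝟙 ⌊ v ≟ b ⌋)))
                            (ℤP.+-mono-≤ (at-most-one (b≢a ∘ sym) u) (at-most-one (b≢a ∘ sym) v))
    where
    interchange : ∀ w x y z → (w + x) + (y + z) ≡ (w + y) + (x + z)
    interchange = solve-∀

  module _ {n : ℕ} (f : Labelling n) where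

    private
      L = allFin n

    kernel-sym : ∀ p p' → kernel f p p' ≡ kernel f p' p
    kernel-sym p p' = ∑-cong L (λ k → ℤP.*-comm (charge f k p) (charge f k p'))

    charge-nonneg : ∀ k p → + 0 ≤ charge f k p
    charge-nonneg k p = ℤP.+-mono-≤ (𝟙-nonneg (inPart f k (proj₁ p))) (𝟙-nonneg (inPart f k (proj₂ p)))

    kernel-nonneg : ∀ p p' → + 0 ≤ kernel f p p'
    kernel-nonneg p p' = ∑-nonneg L (λ k → *-nonneg (charge-nonneg k p) (charge-nonneg k p'))

    kernel-expand : ∀ p p' → kernel f p p' ≡ charge f (lookup f (proj₁ p)) p' + charge f (lookup f (proj₂ p)) p'
    kernel-expand p p' = begin
      ∑ L (λ k → charge f k p * charge f k p')
        ≡⟨ ∑-cong L (λ k → ℤP.*-distribʳ-+ (charge f k p') (𝟙 (inPart f k (proj₁ p))) (𝟙 (inPart f k (proj₂ p)))) ⟩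
      ∑ L (λ k → 𝟙 (inPart f k (proj₁ p)) * charge f k p' + 𝟙 (inPart f k (proj₂ p)) * charge f k p')
        ≡⟨ ∑-+ L _ _ ⟩
      ∑ L (λ k → 𝟙 (inPart f k (proj₁ p)) * charge f k p') + ∑ L (λ k → 𝟙 (inPart f k (proj₂ p)) * charge f k p')
        ≡⟨ cong₂ _+_ (∑-delta n (lookup f (proj₁ p)) (λ k → charge f k p')) (∑-delta n (lookup f (proj₂ p)) (λ k → charge f k p')) ⟩
      charge f (lookup f (proj₁ p)) p' + charge f (lookup f (proj₂ p)) p' ∎
      where open ≡-Reasoning

    kernel-diag : ∀ p → + 1 ≤ kernel f p p
    kernel-diag p = begin
      + 1                                       ≤⟨ ℤP.i≤i+j (+ 1) _ {{ℤ.nonNegative (𝟙-nonneg (inPart f a (proj₂ p)))}} ⟩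
      + 1 + 𝟙 (inPart f a (proj₂ p))            ≡⟨ cong (λ t → 𝟙 t + 𝟙 (inPart f a (proj₂ p))) (sym (⌊≟⌋-true {a = a} refl)) ⟩
      charge f a p                              ≤⟨ ℤP.i≤i+j _ _ {{ℤ.nonNegative (charge-nonneg (lookup f (proj₂ p)) p)}} ⟩
      charge f a p + charge f (lookup f (proj₂ p)) p ≡⟨ sym (kernel-expand p p) ⟩
      kernel f p p                              ∎
      where
      open ℤP.≤-Reasoning
      a = lookup f (proj₁ p)

    kernel-bound : ∀ p p' → kernel f p p' ≤ + 2 * (+ 1 + 𝟙 (sameSide f p))
    kernel-bound p p' = ℤP.≤-trans (ℤP.≤-reflexive (kernel-expand p p'))
      (meetings-bound (lookup f (proj₁ p)) (lookup f (proj₂ p)) (lookup f (proj₁ p')) (lookup f (proj₂ p')))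

  module _ {n : ℕ} (G G' : Graph n) where

    private
      P = pairs n
      L = allFin n

    one-way : Bool → Bool → ℤ
    one-way a b = 𝟙 a * (+ 1 - 𝟙 b)

    either-way : Fin n → Fin n → ℤ
    either-way i j = one-way (adj G i j) (adj G' i j) + one-way (adj G' i j) (adj G i j)

    differ-pos : ∀ a b → a ≢ b → + 1 ≤ one-way a b + one-way b a
    differ-pos true  true  a≢b = contradiction refl a≢b
    differ-pos true  false _   = +≤+ (s≤s z≤n)
    differ-pos false true  _   = +≤+ (s≤s z≤n)
    differ-pos false false a≢b = contradiction refl a≢b

    either-way-nonneg : ∀ i j → + 0 ≤ either-way i j
    either-way-nonneg i j = ℤP.+-mono-≤ (𝟙-and-not-nonneg (adj G i j) (adj G' i j)) (𝟙-and-not-nonneg (adj G' i j) (adj G i j))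

    disagreement-pos : Σ (Fin n) (λ i → Σ (Fin n) (λ j → adj G i j ≢ adj G' i j)) →
      + 1 ≤ + 2 * (∑ P (λ p → one-way (edge G p) (edge G' p)) + ∑ P (λ p → one-way (edge G' p) (edge G p)))
    disagreement-pos (i , j , differ) = begin
      + 1                                       ≤⟨ differ-pos (adj G i j) (adj G' i j) differ ⟩
      either-way i j                            ≤⟨ term≤∑ L (either-way i) (either-way-nonneg i) (∈-allFin j) ⟩
      ∑ L (either-way i)                        ≤⟨ term≤∑ L (λ i → ∑ L (either-way i)) (λ i → ∑-nonneg L (either-way-nonneg i)) (∈-allFin i) ⟩
      ∑ L (λ i → ∑ L (either-way i))            ≡⟨ ∑-offdiagonal n either-way loopless ⟩
      ∑ P (λ p → either-way (proj₁ p) (proj₂ p) + either-way (proj₂ p) (proj₁ p))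
        ≡⟨ ∑-cong P (λ p → symmetric (proj₁ p) (proj₂ p)) ⟩
      ∑ P (λ p → + 2 * either-way (proj₁ p) (proj₂ p))
        ≡⟨ trans (∑-*ˡ P (+ 2) _) (cong (+ 2 *_) (∑-+ P _ _)) ⟩
      + 2 * (∑ P (λ p → one-way (edge G p) (edge G' p)) + ∑ P (λ p → one-way (edge G' p) (edge G p))) ∎
      where
      open ℤP.≤-Reasoning
      loopless : ∀ i → either-way i i ≡ + 0
      loopless i rewrite irrefl G i | irrefl G' i = refl
      symmetric : ∀ i j → either-way i j + either-way j i ≡ + 2 * either-way i j
      symmetric i j rewrite Graph.sym G j i | Graph.sym G' j i = double (either-way i j)
        where
        double : ∀ w → w + w ≡ + 2 * w
        double = solve-∀


module RationalForm where

  open import Data.Integer as ℤ using (ℤ; +_; +<+)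
  import Data.Integer.Properties as ℤP
  open import Data.Integer.Tactic.RingSolver using (solve-∀)
  open import Data.List using (List; []; _∷_; map)
  open import Data.Nat as ℕ using (ℕ; suc; s≤s; z≤n)
  open import Data.Product using (_×_; _,_; proj₁; proj₂)
  open import Data.Rational as ℚ using (ℚ; ∣_∣; _-_; _<_; _≤_; _⊔_; 0ℚ; toℚᵘ)
  import Data.Rational.Properties as ℚP
  open import Data.Rational.Unnormalised as ℚᵘ using (ℚᵘ; mkℚᵘ; *<*; _≃_)
  import Data.Rational.Unnormalised.Properties as ℚᵘP
  open import Data.Sum using (inj₁; inj₂)
  open import Relation.Binary.PropositionalEquality
  import Algebra.Properties.AbelianGroup as AbelianGroupProperties
  open import Defs using (divℕ; maxList)
  open AbstractModularity using (gapNumerator; gapBound; _strictlyWithin_)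

  modularityValue : (e s m : ℕ) → ℚ
  modularityValue e s m = divℕ e m - divℕ s (4 ℕ.* m ℕ.* m)

  p≤∣p∣ : ∀ p → p ≤ ∣ p ∣
  p≤∣p∣ p with ℚP.≤-total 0ℚ p
  ... | inj₁ 0≤p = ℚP.≤-reflexive (sym (ℚP.0≤p⇒∣p∣≡p 0≤p))
  ... | inj₂ p≤0 = ℚP.≤-trans p≤0 (ℚP.0≤∣p∣ p)

  ∣∣<-intro : ∀ {p c} → p < c → ℚ.- p < c → ∣ p ∣ < c
  ∣∣<-intro {p} {c} p<c -p<c with ℚP.∣p∣≡p∨∣p∣≡-p p
  ... | inj₁ ∣p∣≡p  = subst (_< c) (sym ∣p∣≡p) p<c
  ... | inj₂ ∣p∣≡-p = subst (_< c) (sym ∣p∣≡-p) -p<c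

  ∣∣<-elim : ∀ {p c} → ∣ p ∣ < c → p < c × ℚ.- p < c
  ∣∣<-elim {p} ∣p∣<c = ℚP.≤-<-trans (p≤∣p∣ p) ∣p∣<c
                      , ℚP.≤-<-trans (p≤∣p∣ (ℚ.- p)) (subst (_< _) (sym (ℚP.∣-p∣≡∣p∣ p)) ∣p∣<c)

  neg-difference : ∀ x y → ℚ.- (x - y) ≡ y - x
  neg-difference = AbelianGroupProperties.⁻¹-anti-homo‿- ℚP.+-0-abelianGroup

  subtract-more : ∀ x {y y'} → y ≤ y' → x - y' ≤ x - y
  subtract-more x y≤y' = ℚP.+-monoʳ-≤ x (ℚP.neg-antimono-≤ y≤y')

  module _ (c : ℚ) where

    Close : ℚ → ℚ → Set
    Close x y = ∣ x - y ∣ < c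

    Below : ℚ → ℚ → Set
    Below x y = x - y < c

    close⇒below : ∀ x y → Close x y → Below x y × Below y x
    close⇒below x y x≈y with ∣∣<-elim x≈y
    ... | x-y<c , -[x-y]<c = x-y<c , subst (_< c) (neg-difference x y) -[x-y]<c

    below⇒close : ∀ x y → Below x y → Below y x → Close x y
    below⇒close x y x-y<c y-x<c = ∣∣<-intro x-y<c (subst (_< c) (sym (neg-difference x y)) y-x<c)

    below-⊔ : ∀ a a' b b' → Below a a' → Below b b' → Below (a ⊔ b) (a' ⊔ b')
    below-⊔ a a' b b' a≺a' b≺b' with ℚP.⊔-sel a b
    ... | inj₁ a⊔b≡a = subst (λ z → Below z (a' ⊔ b')) (sym a⊔b≡a) (ℚP.≤-<-trans (subtract-more a (ℚP.p≤p⊔q a' b')) a≺a')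
    ... | inj₂ a⊔b≡b = subst (λ z → Below z (a' ⊔ b')) (sym a⊔b≡b) (ℚP.≤-<-trans (subtract-more b (ℚP.p≤q⊔p a' b')) b≺b')

    close-⊔ : ∀ a a' b b' → Close a a' → Close b b' → Close (a ⊔ b) (a' ⊔ b')
    close-⊔ a a' b b' a≈a' b≈b' with close⇒below a a' a≈a' | close⇒below b b' b≈b'
    ... | a≺a' , a'≺a | b≺b' , b'≺b = below⇒close (a ⊔ b) (a' ⊔ b') (below-⊔ a a' b b' a≺a' b≺b') (below-⊔ a' a b' b a'≺a b'≺b)

    module _ {A : Set} (u v : A → ℚ) (u≈v : ∀ z → Close (u z) (v z)) where

      -- maxList (a ∷ z ∷ zs) unfolds to maxList ((a ⊔ z) ∷ zs).
      close-running-max : ∀ a a' zs → Close a a' → Close (maxList (a ∷ map u zs)) (maxList (a' ∷ map v zs))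
      close-running-max a a' []       a≈a' = a≈a'
      close-running-max a a' (z ∷ zs) a≈a' = close-running-max (a ⊔ u z) (a' ⊔ v z) zs (close-⊔ a a' (u z) (v z) a≈a' (u≈v z))

      close-max : 0ℚ < c → ∀ zs → Close (maxList (map u zs)) (maxList (map v zs))
      close-max 0<c []       = 0<c
      close-max 0<c (z ∷ zs) = close-running-max (u z) (v z) zs (u≈v z)

  -- The rational bound is obtained from the integer one by cross-multiplying in ℚᵘ;
  -- toℚᵘ-divℕ and toℚᵘ-- give the unnormalised forms of divℕ and of differences.
  toℚᵘ-divℕ : ∀ x d → toℚᵘ (divℕ x (suc d)) ≃ mkℚᵘ (+ x) d
  toℚᵘ-divℕ x d = ℚP.toℚᵘ-fromℚᵘ (mkℚᵘ (+ x) d)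

  toℚᵘ-- : ∀ p q → toℚᵘ (p - q) ≃ toℚᵘ p ℚᵘ.- toℚᵘ q
  toℚᵘ-- p q = ℚᵘP.≃-trans (ℚP.toℚᵘ-homo-+ p (ℚ.- q)) (ℚᵘP.+-congʳ (toℚᵘ p) (ℚP.toℚᵘ-homo‿- q))

  -‿cong : ∀ {p q r s} → p ≃ q → r ≃ s → p ℚᵘ.- r ≃ q ℚᵘ.- s
  -‿cong p≃q r≃s = ℚᵘP.+-cong p≃q (ℚᵘP.-‿cong r≃s)

  module _ (a b e s e' s' k : ℕ) where

    private
      m m' : ℤ
      m  = + suc a
      m' = + suc b

      Z : ℚᵘ
      Z = (mkℚᵘ (+ e) a ℚᵘ.- mkℚᵘ (+ s) (ℕ.pred (4 ℕ.* suc a ℕ.* suc a)))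
          ℚᵘ.- (mkℚᵘ (+ e') b ℚᵘ.- mkℚᵘ (+ s') (ℕ.pred (4 ℕ.* suc b ℕ.* suc b)))

      bound : ℚᵘ
      bound = mkℚᵘ (+ (2 ℕ.* k)) a

      toℚᵘ-Z : toℚᵘ (modularityValue e s (suc a) - modularityValue e' s' (suc b)) ≃ Z
      toℚᵘ-Z = ℚᵘP.≃-trans (toℚᵘ-- (modularityValue e s (suc a)) (modularityValue e' s' (suc b)))
                 (-‿cong (ℚᵘP.≃-trans (toℚᵘ-- (divℕ e (suc a)) (divℕ s (4 ℕ.* suc a ℕ.* suc a)))
                                      (-‿cong (toℚᵘ-divℕ e a) (toℚᵘ-divℕ s _)))
                         (ℚᵘP.≃-trans (toℚᵘ-- (divℕ e' (suc b)) (divℕ s' (4 ℕ.* suc b ℕ.* suc b)))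
                                      (-‿cong (toℚᵘ-divℕ e' b) (toℚᵘ-divℕ s' _))))

      -- Cross-multiplying Z < bound: both sides are the common positive factor
      -- F = 4 m² m' times the numerator, respectively the bound, of the integer gap.
      F : ℤ
      F = + 4 ℤ.* m ℤ.* m ℤ.* m'

      F-pos : ℤ.Positive F
      F-pos = ℤ.positive (+<+ (s≤s z≤n))

      cross-Z : ℚᵘ.↥ Z ℤ.* ℚᵘ.↧ bound ≡ F ℤ.* gapNumerator m m' (+ e) (+ s) (+ e') (+ s')
      cross-Z = expand (+ a) (+ b) (+ e) (+ s) (+ e') (+ s')
        where
        expand : ∀ α β e s e' s' →
          ((e ℤ.* (+ 4 ℤ.* (+ 1 ℤ.+ α) ℤ.* (+ 1 ℤ.+ α)) ℤ.+ ℤ.- s ℤ.* (+ 1 ℤ.+ α)) ℤ.* ((+ 1 ℤ.+ β) ℤ.* (+ 4 ℤ.* (+ 1 ℤ.+ β) ℤ.* (+ 1 ℤ.+ β)))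
           ℤ.+ ℤ.- (e' ℤ.* (+ 4 ℤ.* (+ 1 ℤ.+ β) ℤ.* (+ 1 ℤ.+ β)) ℤ.+ ℤ.- s' ℤ.* (+ 1 ℤ.+ β)) ℤ.* ((+ 1 ℤ.+ α) ℤ.* (+ 4 ℤ.* (+ 1 ℤ.+ α) ℤ.* (+ 1 ℤ.+ α))))
          ℤ.* (+ 1 ℤ.+ α)
          ≡ (+ 4 ℤ.* (+ 1 ℤ.+ α) ℤ.* (+ 1 ℤ.+ α) ℤ.* (+ 1 ℤ.+ β)) ℤ.*
            (+ 4 ℤ.* (+ 1 ℤ.+ α) ℤ.* (+ 1 ℤ.+ β) ℤ.* (+ 1 ℤ.+ β) ℤ.* e ℤ.- (+ 1 ℤ.+ β) ℤ.* (+ 1 ℤ.+ β) ℤ.* s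
             ℤ.- (+ 4 ℤ.* (+ 1 ℤ.+ α) ℤ.* (+ 1 ℤ.+ α) ℤ.* (+ 1 ℤ.+ β) ℤ.* e' ℤ.- (+ 1 ℤ.+ α) ℤ.* (+ 1 ℤ.+ α) ℤ.* s'))
        expand = solve-∀

      cross-bound : ℚᵘ.↥ bound ℤ.* ℚᵘ.↧ Z ≡ F ℤ.* gapBound m m' (+ k)
      cross-bound = trans (cong (ℤ._* ℚᵘ.↧ Z) (ℤP.pos-* 2 k)) (expand (+ a) (+ b) (+ k))
        where
        expand : ∀ α β κ →
          (+ 2 ℤ.* κ) ℤ.* (((+ 1 ℤ.+ α) ℤ.* (+ 4 ℤ.* (+ 1 ℤ.+ α) ℤ.* (+ 1 ℤ.+ α))) ℤ.* ((+ 1 ℤ.+ β) ℤ.* (+ 4 ℤ.* (+ 1 ℤ.+ β) ℤ.* (+ 1 ℤ.+ β))))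
          ≡ (+ 4 ℤ.* (+ 1 ℤ.+ α) ℤ.* (+ 1 ℤ.+ α) ℤ.* (+ 1 ℤ.+ β)) ℤ.* (+ 8 ℤ.* (+ 1 ℤ.+ α) ℤ.* (+ 1 ℤ.+ β) ℤ.* (+ 1 ℤ.+ β) ℤ.* κ)
        expand = solve-∀

      cross-−Z : ℚᵘ.↥ (ℚᵘ.- Z) ℤ.* ℚᵘ.↧ bound ≡ F ℤ.* ℤ.- gapNumerator m m' (+ e) (+ s) (+ e') (+ s')
      cross-−Z = trans (sym (ℤP.neg-distribˡ-* (ℚᵘ.↥ Z) (ℚᵘ.↧ bound)))
                       (trans (cong ℤ.-_ cross-Z) (ℤP.neg-distribʳ-* F _))

    gap-in-ℚ : gapNumerator m m' (+ e) (+ s) (+ e') (+ s') strictlyWithin gapBound m m' (+ k)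
             → ∣ modularityValue e s (suc a) - modularityValue e' s' (suc b) ∣ < divℕ (2 ℕ.* k) (suc a)
    gap-in-ℚ (N<T , -N<T) = ∣∣<-intro (ℚP.toℚᵘ-cancel-< (rescale toℚᵘ-Z cross-Z cross-bound N<T))
                                    (ℚP.toℚᵘ-cancel-< (rescale toℚᵘ-−Z cross-−Z cross-bound -N<T))
      where
      toℚᵘ-bound : toℚᵘ (divℕ (2 ℕ.* k) (suc a)) ≃ bound
      toℚᵘ-bound = toℚᵘ-divℕ (2 ℕ.* k) a
      toℚᵘ-−Z : toℚᵘ (ℚ.- (modularityValue e s (suc a) - modularityValue e' s' (suc b))) ≃ ℚᵘ.- Z
      toℚᵘ-−Z = ℚᵘP.≃-trans (ℚP.toℚᵘ-homo‿- _) (ℚᵘP.-‿cong toℚᵘ-Z)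
      rescale : ∀ {q Q N} → toℚᵘ q ≃ Q → ℚᵘ.↥ Q ℤ.* ℚᵘ.↧ bound ≡ F ℤ.* N
              → ℚᵘ.↥ bound ℤ.* ℚᵘ.↧ Q ≡ F ℤ.* gapBound m m' (+ k) → N ℤ.< gapBound m m' (+ k)
              → toℚᵘ q ℚᵘ.< toℚᵘ (divℕ (2 ℕ.* k) (suc a))
      rescale q≃Q cross-Q cross-b N<T = ℚᵘP.<-respˡ-≃ (ℚᵘP.≃-sym q≃Q) (ℚᵘP.<-respʳ-≃ (ℚᵘP.≃-sym toℚᵘ-bound)
        (*<* (subst₂ ℤ._<_ (sym cross-Q) (sym cross-b) (ℤP.*-monoˡ-<-pos F {{F-pos}} N<T))))

  maxList-zeros : ∀ {A : Set} (zs : List A) → maxList (map (λ _ → 0ℚ) zs) ≡ 0ℚ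
  maxList-zeros []       = refl
  maxList-zeros (_ ∷ zs) = running zs
    where
    running : ∀ {A : Set} (zs : List A) → maxList (0ℚ ∷ map (λ _ → 0ℚ) zs) ≡ 0ℚ
    running []       = refl
    running (_ ∷ zs) = trans (cong (λ w → maxList (w ∷ map (λ _ → 0ℚ) zs)) (ℚP.⊔-idem 0ℚ)) (running zs)

  divℕ-pos : ∀ {x} d → 1 ℕ.≤ x → 0ℚ < divℕ x (suc d)
  divℕ-pos {suc x} d _ = ℚP.positive⁻¹ _ {{ℚP.normalize-pos (suc x) (suc d)}}


open import Data.Nat as ℕ using (ℕ; zero; suc; _≥_; _*_; s≤s; z≤n)
import Data.Nat.Properties as ℕP
open import Data.Integer as ℤ using (+_; +≤+)
import Data.Integer.Properties as ℤP
open import Data.Fin using (Fin)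
open import Data.List using (map; allFin)
open import Data.Nat.ListAction using (sum)
open import Data.Product using (Σ; _,_; proj₁; proj₂)
open import Data.Sum using (_⊎_; inj₁; inj₂)
open import Data.Rational using (ℚ; 0ℚ; ∣_∣; _-_; _<_)
open import Relation.Binary.PropositionalEquality
open import Defs hiding (sym)
open IntegerSums
open AbstractModularity
open GraphData
open RationalForm

-- q* as a function of the edge count, so that the two cases can be separated.
qStarAt : ∀ {n} → Graph n → ℕ → ℚ
qStarAt     H zero    = 0ℚ
qStarAt {n} H (suc _) = maxList (map (modularity H) (allVecs n n))

qStar-unfold : ∀ {n} (H : Graph n) → qStar H ≡ qStarAt H (numEdges H)
qStar-unfold H with numEdges H
... | zero  = refl
... | suc _ = refl

positive-count : ∀ {x} → 1 ℕ.≤ x → Σ ℕ (λ a → x ≡ suc a)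
positive-count {suc a} _ = a , refl

zero-or-suc : ∀ x → x ≡ 0 ⊎ Σ ℕ (λ b → x ≡ suc b)
zero-or-suc zero    = inj₁ refl
zero-or-suc (suc b) = inj₂ (b , refl)

module _ {n : ℕ} (G G' : Graph n) where

  private
    L = allFin n

  open EdgeCounts (pairs n) (edge G) (edge G')

  m≡ : m ≡ + numEdges G
  m≡ = sym (numEdges-as-∑ G)

  m'≡ : m' ≡ + numEdges G'
  m'≡ = sym (numEdges-as-∑ G')

  k≡ : k ≡ + edgeDiff G G'
  k≡ = sym (edgeDiff-as-∑ G G')

  edgeDiff≤numEdges : edgeDiff G G' ℕ.≤ numEdges G
  edgeDiff≤numEdges = ℤP.drop‿+≤+ (subst₂ ℤ._≤_ k≡ m≡ k≤m)

  edgeDiff-pos : Σ (Fin n) (λ i → Σ (Fin n) (λ j → adj G i j ≢ adj G' i j)) → numEdges G ≥ numEdges G' →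
                 1 ℕ.≤ edgeDiff G G'
  edgeDiff-pos differ m'≤m = ℤP.drop‿+≤+ (subst (+ 1 ℤ.≤_) k≡
    (k-pos (subst₂ ℤ._≤_ (sym m'≡) (sym m≡) (+≤+ m'≤m)) (disagreement-pos G G' differ)))

  module _ (f : Labelling n) where

    open Modularity (pairs n) (sameSide f) (kernel f)

    Σe Σvol² Σe' Σvol²' : ℕ
    Σe     = sum (map (eIn G f) L)
    Σvol²  = sum (map (λ k → vol G f k ℕ.* vol G f k) L)
    Σe'    = sum (map (eIn G' f) L)
    Σvol²' = sum (map (λ k → vol G' f k ℕ.* vol G' f k) L)

    modularity-at : ∀ (H : Graph n) {c} → numEdges H ≡ c →
      modularity H f ≡ modularityValue (sum (map (eIn H f) L)) (sum (map (λ k → vol H f k ℕ.* vol H f k) L)) c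
    modularity-at H = cong (modularityValue _ _)

    partition-gap : ∀ {a b} → numEdges G ≡ suc a → numEdges G' ≡ suc b → b ℕ.≤ a → 1 ℕ.≤ edgeDiff G G' →
      ∣ modularity G f - modularity G' f ∣ < divℕ (2 ℕ.* edgeDiff G G') (suc a)
    partition-gap {a} {b} eG eG' b≤a 1≤k =
      subst₂ (λ q q' → ∣ q - q' ∣ < divℕ (2 ℕ.* edgeDiff G G') (suc a)) (sym (modularity-at G eG)) (sym (modularity-at G' eG'))
        (gap-in-ℚ a b Σe Σvol² Σe' Σvol²' (edgeDiff G G')
          (gap-cong m≡suc m'≡suc (sym (inner-edges-as-∑ G f)) (sym (vol²-as-form G f))
                    (sym (inner-edges-as-∑ G' f)) (sym (vol²-as-form G' f)) k≡ integer-gap))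
      where
      m≡suc : m ≡ + suc a
      m≡suc = trans m≡ (cong +_ eG)
      m'≡suc : m' ≡ + suc b
      m'≡suc = trans m'≡ (cong +_ eG')
      integer-gap : gapNumerator m m' (inner (edge G)) (volume² (edge G)) (inner (edge G')) (volume² (edge G'))
                      strictlyWithin gapBound m m' k
      integer-gap = ModularityGap.Bounds.gap-bounded (pairs n) (sameSide f) (kernel f) (edge G) (edge G')
        (kernel-sym f) (kernel-nonneg f) (kernel-diag f) (kernel-bound f)
        (subst (+ 1 ℤ.≤_) (sym m'≡suc) (+≤+ (s≤s z≤n)))
        (subst₂ ℤ._≤_ (sym m'≡suc) (sym m≡suc) (+≤+ (s≤s b≤a)))
        (subst (+ 1 ℤ.≤_) (sym k≡) (+≤+ 1≤k))

    partition-vs-empty : ∀ {a} → numEdges G ≡ suc a → numEdges G' ≡ 0 →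
      ∣ modularity G f - 0ℚ ∣ < divℕ (2 ℕ.* edgeDiff G G') (suc a)
    partition-vs-empty {a} eG eG' =
      subst (λ q → ∣ q - 0ℚ ∣ < divℕ (2 ℕ.* edgeDiff G G') (suc a)) (sym (modularity-at G eG))
        (gap-in-ℚ a 0 Σe Σvol² 0 0 (edgeDiff G G')
          (gap-cong m≡suc refl (sym (inner-edges-as-∑ G f)) (sym (vol²-as-form G f)) refl refl
                    (trans (sym (k≡m (trans m'≡ (cong +_ eG')))) k≡)
                    (Range.range (kernel-nonneg f) (kernel-bound f) (edge G) (subst (+ 1 ℤ.≤_) (sym m≡suc) (+≤+ (s≤s z≤n))))))
      where
      m≡suc : m ≡ + suc a
      m≡suc = trans m≡ (cong +_ eG)


lemma5p3 : (n : ℕ) (G G' : Graph n)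
    → Σ (Fin n) (λ i → Σ (Fin n) (λ j → adj G i j ≢ adj G' i j))
    → numEdges G ≥ numEdges G'
    → ∣ qStar G - qStar G' ∣ < divℕ (2 * edgeDiff G G') (numEdges G)
lemma5p3 n G G' differ m'≤m =
  subst (λ d → ∣ qStar G - qStar G' ∣ < divℕ (2 * edgeDiff G G') d) (sym eG) (by-size-of-G' (zero-or-suc (numEdges G')))
  where
  1≤k : 1 ℕ.≤ edgeDiff G G'
  1≤k = edgeDiff-pos G G' differ m'≤m
  a : ℕ
  a = proj₁ (positive-count (ℕP.≤-trans 1≤k (edgeDiff≤numEdges G G')))
  eG : numEdges G ≡ suc a
  eG = proj₂ (positive-count (ℕP.≤-trans 1≤k (edgeDiff≤numEdges G G')))
  c : ℚ
  c = divℕ (2 * edgeDiff G G') (suc a)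
  0<c : 0ℚ < c
  0<c = divℕ-pos a (ℕP.≤-trans 1≤k (ℕP.m≤n*m (edgeDiff G G') 2))
  partitions = allVecs n n
  qStar-G : qStar G ≡ maxList (map (modularity G) partitions)
  qStar-G = trans (qStar-unfold G) (cong (qStarAt G) eG)
  by-size-of-G' : numEdges G' ≡ 0 ⊎ Σ ℕ (λ b → numEdges G' ≡ suc b) → ∣ qStar G - qStar G' ∣ < c
  by-size-of-G' (inj₁ eG') =
    subst₂ (λ q q' → ∣ q - q' ∣ < c) (sym qStar-G)
           (sym (trans (qStar-unfold G') (trans (cong (qStarAt G') eG') (sym (maxList-zeros partitions)))))
           (close-max c (modularity G) (λ _ → 0ℚ) (λ f → partition-vs-empty G G' f eG eG') 0<c partitions)
  by-size-of-G' (inj₂ (b , eG')) =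
    subst₂ (λ q q' → ∣ q - q' ∣ < c) (sym qStar-G) (sym (trans (qStar-unfold G') (cong (qStarAt G') eG')))
           (close-max c (modularity G) (modularity G') (λ f → partition-gap G G' f eG eG' b≤a 1≤k) 0<c partitions)
    where
    b≤a : b ℕ.≤ a
    b≤a = ℕP.≤-pred (subst₂ ℕ._≤_ eG' eG m'≤m)
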